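{- There is no positive integral $SL_2$-tiling $(u_{i,j})_{i,j\in\mathbb Z}$ admitting two linearly independent translational symmetries, i.e. there are no linearly independent vectors $(m,n),(m',n')\in\mathbb Z^2$ with $u_{i+m,j+n}=u_{i,j}$ and $u_{i+m',j+n'}=u_{i,j}$ for all $i,j$.
   Context: An $SL_2$-tiling is a family $(u_{i,j})_{i,j\in\mathbb Z}$ of real numbers such that $u_{i+1,j}u_{i,j+1}-u_{i,j}u_{i+1,j+1}=1$ for all $i,j$. It is positive integral if all $u_{i,j}$ are positive integers. -}

module Defs where

open import Data.Integer using (ℤ; _+_; _-_; _*_; _<_; 0ℤ; 1ℤ)
open import Relation.Binary.PropositionalEquality using (_≡_)
open import Relation.Nullary using (¬_)
open import Data.Product using (_×_)

IsSL₂Tiling : (ℤ → ℤ → ℤ) → Set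
IsSL₂Tiling u = ∀ i j →
  u (i + 1ℤ) j * u i (j + 1ℤ) - u i j * u (i + 1ℤ) (j + 1ℤ) ≡ 1ℤ

IsPositiveIntegral : (ℤ → ℤ → ℤ) → Set
IsPositiveIntegral u = ∀ i j → 0ℤ < u i j

IsTranslationSymmetry : (ℤ → ℤ → ℤ) → ℤ → ℤ → Set
IsTranslationSymmetry u m n = ∀ i j → u (i + m) (j + n) ≡ u i j

-- (m , n), (m' , n') linearly independent in ℤ² (equivalently over ℚ/ℝ):
-- the determinant m n' - n m' is nonzero
LinearlyIndependent : ℤ → ℤ → ℤ → ℤ → Set
LinearlyIndependent m n m' n' = ¬ (m * n' - n * m' ≡ 0ℤ)

-- Write vₖ = (u k 0, u k 1). The tiling relation says det(vₖ₊₁, vₖ) = 1, and for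
-- vectors in the right half-plane (positive first coordinates) the three-term Plücker
-- relation makes "det(y, x) > 0" transitive, so det(vₖ₊ₚ, vₖ) > 0 for every p > 0
-- and no nonzero horizontal translation (p, 0) can be a symmetry. On the other hand
-- the symmetries form a subgroup of ℤ², which contains
-- n'·(m, n) - n·(m', n') = (m n' - n m', 0), a nonzero horizontal translation.
module Submission where

open import Data.Empty using (⊥)
open import Data.Integer
  using (ℤ; +_; +[1+_]; -[1+_]; 0ℤ; 1ℤ; _+_; _-_; _*_; -_; _<_; +<+; positive; nonNegative)
open import Data.Integer.Properties
open import Data.Integer.Tactic.RingSolver using (solve-∀)
open import Data.Nat using (zero; suc; z<s)
open import Data.Product using (_×_; _,_)
open import Relation.Binary.PropositionalEquality
open import Relation.Nullary using (¬_)

open import Defs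

i>0∧j>0⇒i*j>0 : ∀ {i j} → 0ℤ < i → 0ℤ < j → 0ℤ < i * j
i>0∧j>0⇒i*j>0 {i} {j} i>0 j>0 =
  subst (_< i * j) (*-zeroʳ i) (*-monoˡ-<-pos i {{positive i>0}} j>0)

i>0∧i*j>0⇒j>0 : ∀ {i j} → 0ℤ < i → 0ℤ < i * j → 0ℤ < j
i>0∧i*j>0⇒j>0 {i} {j} i>0 i*j>0 =
  *-cancelˡ-<-nonNeg i {{nonNegative (<⇒≤ i>0)}} (subst (_< i * j) (sym (*-zeroʳ i)) i*j>0)

module _ (u : ℤ → ℤ → ℤ) where

  private
    Symmetry = IsTranslationSymmetry u

  symmetry-zero : Symmetry 0ℤ 0ℤ
  symmetry-zero i j = cong₂ u (+-identityʳ i) (+-identityʳ j)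

  symmetry-+ : ∀ {m n m' n'} → Symmetry m n → Symmetry m' n' → Symmetry (m + m') (n + n')
  symmetry-+ {m} {n} {m'} {n'} s s' i j = begin
    u (i + (m + m')) (j + (n + n')) ≡⟨ cong₂ u (sym (+-assoc i m m')) (sym (+-assoc j n n')) ⟩
    u (i + m + m') (j + n + n')     ≡⟨ s' (i + m) (j + n) ⟩
    u (i + m) (j + n)               ≡⟨ s i j ⟩
    u i j                           ∎
    where open ≡-Reasoning

  symmetry-neg : ∀ {m n} → Symmetry m n → Symmetry (- m) (- n)
  symmetry-neg {m} {n} s i j =
    trans (sym (s (i - m) (j - n))) (cong₂ u (i-j+j≡i i m) (i-j+j≡i j n))
    where
    i-j+j≡i : ∀ i j → i - j + j ≡ i
    i-j+j≡i = solve-∀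

  symmetry-*ℕ : ∀ {m n} → Symmetry m n → ∀ k → Symmetry (+ k * m) (+ k * n)
  symmetry-*ℕ {m} {n} s zero =
    subst₂ Symmetry (sym (*-zeroˡ m)) (sym (*-zeroˡ n)) symmetry-zero
  symmetry-*ℕ {m} {n} s (suc k) =
    subst₂ Symmetry (sym (suc-* (+ k) m)) (sym (suc-* (+ k) n)) (symmetry-+ s (symmetry-*ℕ s k))

  symmetry-* : ∀ {m n} → Symmetry m n → ∀ k → Symmetry (k * m) (k * n)
  symmetry-* s (+ k) = symmetry-*ℕ s k
  symmetry-* {m} {n} s -[1+ k ] =
    subst₂ Symmetry (neg-distribˡ-* (+[1+ k ]) m) (neg-distribˡ-* (+[1+ k ]) n)
      (symmetry-neg (symmetry-*ℕ s (suc k)))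

  symmetry-horizontal : ∀ {m n m' n'} → Symmetry m n → Symmetry m' n' →
    Symmetry (m * n' - n * m') 0ℤ
  symmetry-horizontal {m} {n} {m'} {n'} s s' =
    subst₂ Symmetry (first-coordinate m n m' n') (second-coordinate n n')
      (symmetry-+ (symmetry-* s n') (symmetry-* s' (- n)))
    where
    first-coordinate : ∀ m n m' n' → n' * m + - n * m' ≡ m * n' - n * m'
    first-coordinate = solve-∀
    second-coordinate : ∀ n n' → n' * n + - n * n' ≡ 0ℤ
    second-coordinate = solve-∀

-- Factors ordered so that det (column (i + 1)) (column i) is literally the tiling relation.
det : ℤ × ℤ → ℤ × ℤ → ℤ
det (a , b) (c , d) = a * d - c * b

det-self : ∀ v → det v v ≡ 0ℤ
det-self (a , b) = +-inverseʳ (a * b)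

det-plücker : ∀ a₀ b₀ a₁ b₁ a₂ b₂ →
  a₁ * det (a₂ , b₂) (a₀ , b₀) ≡ a₀ * det (a₂ , b₂) (a₁ , b₁) + a₂ * det (a₁ , b₁) (a₀ , b₀)
det-plücker = plücker
  where
  plücker : ∀ a₀ b₀ a₁ b₁ a₂ b₂ →
    a₁ * (a₂ * b₀ - a₀ * b₂) ≡ a₀ * (a₂ * b₁ - a₁ * b₂) + a₂ * (a₁ * b₀ - a₀ * b₁)
  plücker = solve-∀

det-pos-trans : ∀ {a₀ b₀ a₁ b₁ a₂ b₂} → 0ℤ < a₀ → 0ℤ < a₁ → 0ℤ < a₂ →
  0ℤ < det (a₁ , b₁) (a₀ , b₀) → 0ℤ < det (a₂ , b₂) (a₁ , b₁) →
  0ℤ < det (a₂ , b₂) (a₀ , b₀)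
det-pos-trans {a₀} {b₀} {a₁} {b₁} {a₂} {b₂} a₀>0 a₁>0 a₂>0 d₁₀>0 d₂₁>0 =
  i>0∧i*j>0⇒j>0 a₁>0 (subst (0ℤ <_) (sym (det-plücker a₀ b₀ a₁ b₁ a₂ b₂))
    (+-mono-< (i>0∧j>0⇒i*j>0 a₀>0 d₂₁>0) (i>0∧j>0⇒i*j>0 a₂>0 d₁₀>0)))

module _ {u : ℤ → ℤ → ℤ} (tiling : IsSL₂Tiling u) (u>0 : IsPositiveIntegral u) where

  column : ℤ → ℤ × ℤ
  column i = u i 0ℤ , u i 1ℤ

  det-column-pos : ∀ i k → 0ℤ < det (column (i + + suc k)) (column i)
  det-column-pos i zero = subst (0ℤ <_) (sym (tiling i 0ℤ)) (+<+ z<s)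
  det-column-pos i (suc k) =
    subst (λ l → 0ℤ < det (column l) (column i)) (+-assoc i 1ℤ (+ suc k))
      (det-pos-trans (u>0 _ _) (u>0 _ _) (u>0 _ _)
        (det-column-pos i zero) (det-column-pos (i + 1ℤ) k))

  no-rightward-period : ∀ k → ¬ IsTranslationSymmetry u (+ suc k) 0ℤ
  no-rightward-period k s = <-irrefl (sym (det-self (column 0ℤ))) det>0
    where
    det>0 : 0ℤ < det (column 0ℤ) (column 0ℤ)
    det>0 = subst (λ v → 0ℤ < det v (column 0ℤ))
      (cong₂ _,_ (s 0ℤ 0ℤ) (s 0ℤ 1ℤ)) (det-column-pos 0ℤ k)

  no-horizontal-period : ∀ p → ¬ p ≡ 0ℤ → ¬ IsTranslationSymmetry u p 0ℤ
  no-horizontal-period (+ zero) p≢0 _ = p≢0 refl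
  no-horizontal-period +[1+ k ] _ s = no-rightward-period k s
  no-horizontal-period -[1+ k ] _ s = no-rightward-period k (symmetry-neg u s)

corollary5p4 : (u : ℤ → ℤ → ℤ) → IsSL₂Tiling u → IsPositiveIntegral u →
    (m n m' n' : ℤ) → LinearlyIndependent m n m' n' →
    IsTranslationSymmetry u m n → IsTranslationSymmetry u m' n' → ⊥
corollary5p4 u tiling u>0 m n m' n' independent s s' =
  no-horizontal-period tiling u>0 (m * n' - n * m') independent
    (symmetry-horizontal u s s')
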